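{- Let $M$ be a matroid of finite rank on ground set $E$ with rank function $r$, let $\mathcal{F}=\{F_1,\dots,F_k\}$ be a chain of flats with $\emptyset=F_0\subset F_1\subset\cdots\subset F_k\subset F_{k+1}=E$, and let $\mathcal{F}'\supset\mathcal{F}$ be a longer chain of flats of $M$. Let $X=X_0\cup\cdots\cup X_k\subseteq E$ with $X_i\subseteq F_{i+1}\setminus F_i$, and suppose $r_{M\star\mathcal{F}}(X)=r_{M\star\mathcal{F}'}(X)$. Then $\phi(\mathcal{F},X)\leq\phi(\mathcal{F}',X)$, and equality holds if and only if $\mathcal{F}'\cup\{F_i\vee X_i : i=0,\dots,k\}$ is a chain.
   Context: For a chain of flats $\mathcal{G}=\{G_1\subset\cdots\subset G_m\}$ of $M$ (with $G_0:=\emptyset$, $G_{m+1}:=E$), the matroid $M\star\mathcal{G}$ on $E$ is the direct sum $\bigoplus_{i=0}^m (M|G_{i+1})/G_i$, with rank function $r_{M\star\mathcal{G}}(Y)=\sum_{i=0}^m\bigl(r(Y_i\cup G_i)-r(G_i)\bigr)$ where $Y_i:=Y\cap(G_{i+1}\setminus G_i)$; and $\phi(\mathcal{G},Y):=\sum_{i=0}^m\bigl[r(G_i\cup Y_i)^2-r(G_i)^2\bigr]$. For a flat $F$ and set $Y$, $F\vee Y$ denotes the closure in $M$ of $F\cup Y$. -}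

module Defs where

open import Level using (0ℓ)
open import Data.Nat using (ℕ; zero; suc; _+_; _*_; _∸_; _≤_)
open import Data.Fin using (Fin; zero; suc; inject₁)
open import Data.Product using (Σ; _×_; _,_; ∃-syntax)
open import Data.Sum using (_⊎_)
open import Data.List using (List)
open import Data.List.Relation.Unary.All using (All)
open import Data.List.Relation.Unary.Any using (Any)
open import Relation.Binary.PropositionalEquality using (_≡_)
open import Relation.Unary using (Pred; ∅; U; ｛_｝; _∪_; _∩_; _∖_; _⊆_; _⊂_; _≐_; ⋃)

Subset : Set → Set₁
Subset E = Pred E 0ℓ

listSet : {E : Set} → List E → Subset E
listSet L = λ e → Any (e ≡_) L

-- A matroid of finite rank on an arbitrary ground type E, given by its
-- rank function r : 2^E → ℕ (finite-valued, so the rank is finite).  For finite E this is the usual rank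
-- axiomatisation; for infinite E it is the standard one for finitary
-- matroids of finite rank.
record Matroid (E : Set) : Set₁ where
  field
    r        : Subset E → ℕ
    r-resp   : ∀ {X Y : Subset E} → X ≐ Y → r X ≡ r Y
    r-empty  : r ∅ ≡ 0
    r-unit   : ∀ (X : Subset E) (e : E) → r (X ∪ ｛ e ｝) ≤ Data.Nat.suc (r X)
    r-mono   : ∀ {X Y : Subset E} → X ⊆ Y → r X ≤ r Y
    r-submod : ∀ (X Y : Subset E) → r (X ∪ Y) + r (X ∩ Y) ≤ r X + r Y
    r-finitary : ∀ (X : Subset E) →
                 Σ (List E) λ L → All X L × r (listSet L) ≡ r X

∑ : (n : ℕ) → (Fin n → ℕ) → ℕ
∑ zero    f = 0
∑ (suc n) f = f zero + ∑ n (λ i → f (suc i))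

module _ {E : Set} (M : Matroid E) where
  open Matroid M

  cl : Subset E → Subset E
  cl Y = λ e → r (Y ∪ ｛ e ｝) ≡ r Y

  IsFlat : Subset E → Set
  IsFlat F = ∀ e → r (F ∪ ｛ e ｝) ≡ r F → F e

  _∨_ : Subset E → Subset E → Subset E
  F ∨ Y = cl (F ∪ Y)

  -- A chain of flats G₁ ⊂ ⋯ ⊂ Gₘ, given as G : Fin m → Subset E
  -- (G zero = G₁, …).
  IsChainOfFlats : (m : ℕ) → (Fin m → Subset E) → Set
  IsChainOfFlats m G =
    (∀ i → IsFlat (G i)) ×
    (∀ (i : Fin m) (j : Fin m) → Data.Fin._<_ i j → G i ⊂ G j)

-- Extension of a chain G₁,…,Gₘ by G₀ := ∅ and G_{m+1} := E.
-- extTop G i = G_{i+1} for i = 0,…,m.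
extTop : {E : Set} (m : ℕ) → (Fin m → Subset E) → Fin (suc m) → Subset E
extTop zero    G zero    = U
extTop (suc m) G zero    = G zero
extTop (suc m) G (suc i) = extTop m (λ j → G (suc j)) i

-- ext G i = G_i for i = 0,…,m+1.
ext : {E : Set} (m : ℕ) → (Fin m → Subset E) → Fin (suc (suc m)) → Subset E
ext m G zero    = ∅
ext m G (suc i) = extTop m G i

module _ {E : Set} (M : Matroid E) where
  open Matroid M

  -- Lower and upper flat of the i-th layer, i = 0,…,m.
  lo : (m : ℕ) → (Fin m → Subset E) → Fin (suc m) → Subset E
  lo m G i = ext m G (inject₁ i)

  hi : (m : ℕ) → (Fin m → Subset E) → Fin (suc m) → Subset E
  hi m G i = ext m G (suc i)

  piece : (m : ℕ) → (Fin m → Subset E) → Subset E → Fin (suc m) → Subset E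
  piece m G Y i = Y ∩ (hi m G i ∖ lo m G i)

  -- r_{M⋆G}(Y) = ∑_i ( r(Y_i ∪ G_i) − r(G_i) )   (each term is ≥ 0)
  rStar : (m : ℕ) → (Fin m → Subset E) → Subset E → ℕ
  rStar m G Y = ∑ (suc m) λ i → r (piece m G Y i ∪ lo m G i) ∸ r (lo m G i)

  -- φ(G,Y) = ∑_i ( r(G_i ∪ Y_i)² − r(G_i)² )   (each term is ≥ 0)
  φ : (m : ℕ) → (Fin m → Subset E) → Subset E → ℕ
  φ m G Y = ∑ (suc m) λ i →
    (r (lo m G i ∪ piece m G Y i) * r (lo m G i ∪ piece m G Y i))
      ∸ (r (lo m G i) * r (lo m G i))

IsChainFamily : {E : Set} {I : Set} → (I → Subset E) → Set
IsChainFamily {I = I} A = ∀ (a b : I) → (A a ⊆ A b) ⊎ (A b ⊆ A a)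

module Submission where

open import Defs
open import Data.Nat using (ℕ; zero; suc; _+_; _*_; _∸_; _≤_; _<_; s≤s; z≤n; _<?_; _≤?_)
open import Data.Nat.Properties
open import Data.Nat.Tactic.RingSolver using (solve-∀)
open import Data.Fin using (Fin; zero; suc; toℕ; fromℕ<; inject₁)
open import Data.Fin.Properties using (toℕ-fromℕ<; toℕ-inject₁; toℕ-injective; toℕ<n)
open import Data.Unit using (tt)
open import Data.Empty using (⊥-elim)
open import Data.Product using (Σ; _×_; _,_; proj₁; proj₂)
open import Data.Sum using (_⊎_; inj₁; inj₂; [_,_]; swap)
open import Data.List using (List; []; _∷_)
open import Data.List.Relation.Unary.All using (All; []; _∷_)
open import Data.List.Relation.Unary.Any using (here; there)
open import Function using (_∘′_)
open import Function.Bundles using (_⇔_; mk⇔; Equivalence)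
import Function.Properties.Equivalence as ⇔
open import Relation.Nullary using (yes; no)
open import Relation.Binary.Definitions using (tri<; tri≈; tri>)
open import Relation.Binary.PropositionalEquality using (_≡_; _≢_; refl; sym; trans; cong; cong₂; subst)
open import Relation.Unary using (∅; U; ｛_｝; _∪_; _∩_; _∖_; _⊆_; _≐_; ⋃)
open import Relation.Unary.Properties using (≐-refl; ≐-sym; ≐-trans)
open ≤-Reasoning

-- Walk up the fine chain ∅ = F′_0 ⊆ ⋯ ⊆ F′_{k′+1} = E.  Every fine step m lies
-- inside one layer F_i ⊆ F_{i+1} of the coarse chain.  For S = F′_m consider the
-- truncations t_i(S) = r(F_i ∪ (X_i ∩ S)) of the coarse pieces of Y and the sums
-- R(S) = Σ_i (t_i(S) − r F_i) and Ψ(S) = Σ_i (t_i(S)² − (r F_i)²): they vanish at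
-- S = ∅ and equal r_{M⋆F}(Y) and φ(F, Y) at S = E, while the fine steps
-- contribute the terms D_m, A_m of r_{M⋆F′}(Y) and φ(F′, Y).  A step changes only
-- t_i, and submodularity gives R(F′_{m+1}) ≥ R(F′_m) + D_m; summing up, the rank
-- hypothesis forces all these to be equalities.  An identity for squares then
-- gives Ψ(F′_{m+1}) ≤ Ψ(F′_m) + A_m, with equality iff the step is Tight, and
-- telescoping yields the inequality and "equality ⇔ all steps Tight".  Finally
-- all steps are Tight iff F′ ∪ {F_i ∨ X_i} is a chain.

-- m ≤ n viewed as n = m + d; matching on it eliminates n in favour of m + d.
data _≤ᵛ_ (m : ℕ) : ℕ → Set where
  plus : ∀ d → m ≤ᵛ (m + d)

≤-view : ∀ {m n} → m ≤ n → m ≤ᵛ n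
≤-view {m} m≤n with m≤n⇒∃[o]m+o≡n m≤n
... | d , refl = plus d

-- Transferring a comparison between two sums that differ in one summand
-- (U + v ≡ V + u says "U, V differ exactly as u, v do") to that summand.
exchange-≤ : ∀ {U V u v} d → U + v ≡ V + u → u + d ≤ v → U + d ≤ V
exchange-≤ {U} {V} {u} {v} d e h = +-cancelʳ-≤ v (U + d) V (begin
  U + d + v   ≡⟨ +-assoc U d v ⟩
  U + (d + v) ≡⟨ cong (U +_) (+-comm d v) ⟩
  U + (v + d) ≡⟨ +-assoc U v d ⟨
  U + v + d   ≡⟨ cong (_+ d) e ⟩
  V + u + d   ≡⟨ +-assoc V u d ⟩
  V + (u + d) ≤⟨ +-monoʳ-≤ V h ⟩
  V + v       ∎)

exchange-≥ : ∀ {U V u v} d → U + v ≡ V + u → v ≤ u + d → V ≤ U + d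
exchange-≥ {U} {V} {u} {v} d e h = +-cancelʳ-≤ u V (U + d) (begin
  V + u       ≡⟨ e ⟨
  U + v       ≤⟨ +-monoʳ-≤ U h ⟩
  U + (u + d) ≡⟨ cong (U +_) (+-comm u d) ⟩
  U + (d + u) ≡⟨ +-assoc U d u ⟨
  U + d + u   ∎)

exchange-≡ : ∀ {U V u v} d → U + v ≡ V + u → (U + d ≡ V ⇔ u + d ≡ v)
exchange-≡ {U} {V} {u} {v} d e = mk⇔
  (λ h → +-cancelˡ-≡ V (u + d) v (begin-equality
     V + (u + d) ≡⟨ +-assoc V u d ⟨
     V + u + d   ≡⟨ cong (_+ d) e ⟨
     U + v + d   ≡⟨ +-assoc U v d ⟩
     U + (v + d) ≡⟨ cong (U +_) (+-comm v d) ⟩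
     U + (d + v) ≡⟨ +-assoc U d v ⟨
     U + d + v   ≡⟨ cong (_+ v) h ⟩
     V + v       ∎))
  (λ h → +-cancelʳ-≡ v (U + d) V (begin-equality
     U + d + v   ≡⟨ +-assoc U d v ⟩
     U + (d + v) ≡⟨ cong (U +_) (+-comm d v) ⟩
     U + (v + d) ≡⟨ +-assoc U v d ⟨
     U + v + d   ≡⟨ cong (_+ d) e ⟩
     V + u + d   ≡⟨ +-assoc V u d ⟩
     V + (u + d) ≡⟨ cong (V +_) h ⟩
     V + v       ∎))

cross-≤ : ∀ {a s b u} → a + s ≡ b + u → a ≤ u → b ≤ s
cross-≤ {a} {s} {b} {u} e a≤u = +-cancelʳ-≤ u b s (begin
  b + u ≡⟨ e ⟨
  a + s ≤⟨ +-monoˡ-≤ s a≤u ⟩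
  u + s ≡⟨ +-comm u s ⟩
  s + u ∎)

gain-≤ : ∀ {c s b a u} → c ≤ s → b ≤ a → c ≤ u → a + s ≤ b + u →
         (s ∸ c) + (a ∸ b) ≤ u ∸ c
gain-≤ {c} {b = b} c≤s b≤a c≤u h with ≤-view c≤s | ≤-view b≤a | ≤-view c≤u
... | plus q | plus d | plus o = begin
  (c + q ∸ c) + (b + d ∸ b) ≡⟨ cong₂ _+_ (m+n∸m≡n c q) (m+n∸m≡n b d) ⟩
  q + d                     ≤⟨ +-cancelˡ-≤ (b + c) (q + d) o (begin
                                 b + c + (q + d)   ≡⟨ shuffle b c q d ⟩
                                 b + d + (c + q)   ≤⟨ h ⟩
                                 b + (c + o)       ≡⟨ +-assoc b c o ⟨
                                 b + c + o         ∎) ⟩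
  o                         ≡⟨ m+n∸m≡n c o ⟨
  c + o ∸ c                 ∎
  where
  shuffle : ∀ b c q d → b + c + (q + d) ≡ b + d + (c + q)
  shuffle = solve-∀

gain-≡ : ∀ {c s b a u} → c ≤ s → b ≤ a → c ≤ u →
         (s ∸ c) + (a ∸ b) ≡ u ∸ c → a + s ≡ b + u
gain-≡ {c} {b = b} c≤s b≤a c≤u h with ≤-view c≤s | ≤-view b≤a | ≤-view c≤u
... | plus q | plus d | plus o = begin-equality
  b + d + (c + q)   ≡⟨ shuffle b c q d ⟩
  b + c + (q + d)   ≡⟨ cong (λ x → b + c + x) (begin-equality
                         q + d                     ≡⟨ cong₂ _+_ (m+n∸m≡n c q) (m+n∸m≡n b d) ⟨
                         (c + q ∸ c) + (b + d ∸ b) ≡⟨ h ⟩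
                         c + o ∸ c                 ≡⟨ m+n∸m≡n c o ⟩
                         o                         ∎) ⟩
  b + c + o         ≡⟨ +-assoc b c o ⟩
  b + (c + o)       ∎
  where
  shuffle : ∀ b c q d → b + d + (c + q) ≡ b + c + (q + d)
  shuffle = solve-∀

square-gain : ∀ m n → (m + n) * (m + n) ∸ m * m ≡ n * n + 2 * m * n
square-gain m n = begin-equality
  (m + n) * (m + n) ∸ m * m               ≡⟨ cong (_∸ m * m) (expand m n) ⟩
  m * m + (n * n + 2 * m * n) ∸ m * m     ≡⟨ m+n∸m≡n (m * m) _ ⟩
  n * n + 2 * m * n                       ∎
  where
  expand : ∀ m n → (m + n) * (m + n) ≡ m * m + (n * n + 2 * m * n)
  expand = solve-∀

private
  solve-u : ∀ c q p d {u} → c + q + p + d + (c + q) ≡ c + q + p + u → u ≡ c + (q + d)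
  solve-u c q p d {u} e = +-cancelˡ-≡ (c + q + p) u (c + (q + d))
    (trans (sym e) (rearrange c q p d))
    where
    rearrange : ∀ c q p d → c + q + p + d + (c + q) ≡ c + q + p + (c + (q + d))
    rearrange = solve-∀

square-defect : ∀ {c s b a u} → c ≤ s → s ≤ b → b ≤ a → a + s ≡ b + u →
                (s * s ∸ c * c) + (a * a ∸ b * b)
                  ≡ (u * u ∸ c * c) + 2 * (b ∸ s) * (a ∸ b)
square-defect {c} c≤s s≤b b≤a e with ≤-view c≤s | ≤-view s≤b | ≤-view b≤a
... | plus q | plus p | plus d with solve-u c q p d e
...   | refl = begin-equality
  ((c + q) * (c + q) ∸ c * c) + (a * a ∸ b * b)
    ≡⟨ cong₂ _+_ (square-gain c q) (square-gain b d) ⟩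
  (q * q + 2 * c * q) + (d * d + 2 * b * d)
    ≡⟨ regroup c q p d ⟩
  ((q + d) * (q + d) + 2 * c * (q + d)) + 2 * p * d
    ≡⟨ cong₂ _+_ (square-gain c (q + d))
                 (cong₂ (λ x y → 2 * x * y) (m+n∸m≡n (c + q) p) (m+n∸m≡n b d)) ⟨
  ((c + (q + d)) * (c + (q + d)) ∸ c * c) + 2 * (b ∸ (c + q)) * (a ∸ b)
    ∎
  where
  b a : ℕ
  b = c + q + p
  a = b + d
  regroup : ∀ c q p d → (q * q + 2 * c * q) + (d * d + 2 * (c + q + p) * d)
                        ≡ ((q + d) * (q + d) + 2 * c * (q + d)) + 2 * p * d
  regroup = solve-∀

square-≤ : ∀ {c s b a u} → c ≤ s → s ≤ b → b ≤ a → a + s ≡ b + u →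
           u * u ∸ c * c ≤ (s * s ∸ c * c) + (a * a ∸ b * b)
square-≤ c≤s s≤b b≤a e =
  ≤-trans (m≤m+n _ _) (≤-reflexive (sym (square-defect c≤s s≤b b≤a e)))

square-tight : ∀ {c s b a u} → c ≤ s → s ≤ b → b ≤ a → a + s ≡ b + u →
               (u * u ∸ c * c ≡ (s * s ∸ c * c) + (a * a ∸ b * b)) ⇔ (b ≤ s ⊎ a ≤ b)
square-tight {c} {s} {b} {a} {u} c≤s s≤b b≤a e = mk⇔
  (λ h → defect-zero⇒ (+-cancelˡ-≡ G D 0
     (trans (sym (trans h (square-defect c≤s s≤b b≤a e))) (sym (+-identityʳ G)))))
  (λ cond → sym (begin-equality
     (s * s ∸ c * c) + (a * a ∸ b * b) ≡⟨ square-defect c≤s s≤b b≤a e ⟩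
     G + D                             ≡⟨ cong (G +_) (⇒defect-zero cond) ⟩
     G + 0                             ≡⟨ +-identityʳ G ⟩
     G                                 ∎))
  where
  G D : ℕ
  G = u * u ∸ c * c
  D = 2 * (b ∸ s) * (a ∸ b)
  defect-zero⇒ : D ≡ 0 → b ≤ s ⊎ a ≤ b
  defect-zero⇒ D≡0 with m*n≡0⇒m≡0∨n≡0 (2 * (b ∸ s)) D≡0
  ... | inj₂ a∸b≡0 = inj₂ (m∸n≡0⇒m≤n a∸b≡0)
  ... | inj₁ 2[b∸s]≡0 with m*n≡0⇒m≡0∨n≡0 2 2[b∸s]≡0
  ...   | inj₂ b∸s≡0 = inj₁ (m∸n≡0⇒m≤n b∸s≡0)
  ⇒defect-zero : b ≤ s ⊎ a ≤ b → D ≡ 0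
  ⇒defect-zero (inj₁ b≤s) rewrite m≤n⇒m∸n≡0 b≤s = refl
  ⇒defect-zero (inj₂ a≤b) rewrite m≤n⇒m∸n≡0 a≤b = *-zeroʳ (2 * (b ∸ s))

∑-cong : ∀ n {f g : Fin n → ℕ} → (∀ i → f i ≡ g i) → ∑ n f ≡ ∑ n g
∑-cong zero    f≗g = refl
∑-cong (suc n) f≗g = cong₂ _+_ (f≗g zero) (∑-cong n (λ i → f≗g (suc i)))

∑-zero : ∀ n → ∑ n (λ _ → 0) ≡ 0
∑-zero zero    = refl
∑-zero (suc n) = ∑-zero n

∑-update : ∀ n (u v : Fin n → ℕ) (i₀ : Fin n) → (∀ i → i ≢ i₀ → u i ≡ v i) →
           ∑ n u + v i₀ ≡ ∑ n v + u i₀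
∑-update (suc n) u v zero agree = begin-equality
  u zero + ∑ n u′ + v zero ≡⟨ swap-ends (u zero) (∑ n u′) (v zero) ⟩
  v zero + ∑ n u′ + u zero ≡⟨ cong (λ x → v zero + x + u zero)
                                (∑-cong n (λ i → agree (suc i) λ ())) ⟩
  v zero + ∑ n v′ + u zero ∎
  where
  u′ v′ : Fin n → ℕ
  u′ i = u (suc i)
  v′ i = v (suc i)
  swap-ends : ∀ x y z → x + y + z ≡ z + y + x
  swap-ends = solve-∀
∑-update (suc n) u v (suc i₀) agree = begin-equality
  u zero + ∑ n u′ + v (suc i₀)   ≡⟨ +-assoc (u zero) _ _ ⟩
  u zero + (∑ n u′ + v (suc i₀)) ≡⟨ cong₂ _+_ (agree zero λ ())
                                      (∑-update n u′ v′ i₀ (λ i i≢i₀ → agree (suc i) (λ { refl → i≢i₀ refl }))) ⟩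
  v zero + (∑ n v′ + u (suc i₀)) ≡⟨ +-assoc (v zero) _ _ ⟨
  v zero + ∑ n v′ + u (suc i₀)   ∎
  where
  u′ v′ : Fin n → ℕ
  u′ i = u (suc i)
  v′ i = v (suc i)

sumTo : ℕ → (ℕ → ℕ) → ℕ
sumTo zero    f = 0
sumTo (suc n) f = f 0 + sumTo n (λ m → f (suc m))

∑-toℕ : ∀ n (f : ℕ → ℕ) → ∑ n (λ j → f (toℕ j)) ≡ sumTo n f
∑-toℕ zero    f = refl
∑-toℕ (suc n) f = cong (f 0 +_) (∑-toℕ n (λ m → f (suc m)))

sumTo-zero : ∀ n → sumTo n (λ _ → 0) ≡ 0
sumTo-zero zero    = refl
sumTo-zero (suc n) = sumTo-zero n

sumTo-+ : ∀ n (f g : ℕ → ℕ) → sumTo n (λ m → f m + g m) ≡ sumTo n f + sumTo n g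
sumTo-+ zero    f g = refl
sumTo-+ (suc n) f g = begin-equality
  f 0 + g 0 + sumTo n (λ m → f (suc m) + g (suc m))
    ≡⟨ cong (f 0 + g 0 +_) (sumTo-+ n (λ m → f (suc m)) (λ m → g (suc m))) ⟩
  f 0 + g 0 + (sumTo n (λ m → f (suc m)) + sumTo n (λ m → g (suc m)))
    ≡⟨ interchange (f 0) (g 0) _ _ ⟩
  f 0 + sumTo n (λ m → f (suc m)) + (g 0 + sumTo n (λ m → g (suc m)))
    ∎
  where
  interchange : ∀ w x y z → w + x + (y + z) ≡ w + y + (x + z)
  interchange = solve-∀

sumTo-≡0 : ∀ n (f : ℕ → ℕ) → sumTo n f ≡ 0 → ∀ m → m < n → f m ≡ 0
sumTo-≡0 (suc n) f Σ≡0 zero    _         = m+n≡0⇒m≡0 (f 0) Σ≡0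
sumTo-≡0 (suc n) f Σ≡0 (suc m) (s≤s m<n) =
  sumTo-≡0 n (λ m → f (suc m)) (m+n≡0⇒n≡0 (f 0) Σ≡0) m m<n

telescope : ∀ n (P e a : ℕ → ℕ) → (∀ m → m < n → P (suc m) + e m ≡ P m + a m) →
            P n + sumTo n e ≡ P 0 + sumTo n a
telescope zero    P e a step = refl
telescope (suc n) P e a step = begin-equality
  P (suc n) + (e 0 + sumTo n e′) ≡⟨ move-last (P (suc n)) (e 0) _ ⟩
  P (suc n) + sumTo n e′ + e 0   ≡⟨ cong (_+ e 0) (telescope n (λ m → P (suc m)) e′ a′
                                       (λ m m<n → step (suc m) (s≤s m<n))) ⟩
  P 1 + sumTo n a′ + e 0         ≡⟨ move-last (P 1) (e 0) _ ⟨
  P 1 + (e 0 + sumTo n a′)       ≡⟨ +-assoc (P 1) _ _ ⟨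
  P 1 + e 0 + sumTo n a′         ≡⟨ cong (_+ sumTo n a′) (step 0 (s≤s z≤n)) ⟩
  P 0 + a 0 + sumTo n a′         ≡⟨ +-assoc (P 0) _ _ ⟩
  P 0 + (a 0 + sumTo n a′)       ∎
  where
  e′ a′ : ℕ → ℕ
  e′ m = e (suc m)
  a′ m = a (suc m)
  move-last : ∀ x y z → x + (y + z) ≡ x + z + y
  move-last = solve-∀

module RisesAtLeast (n : ℕ) (P a : ℕ → ℕ) (rises : ∀ m → m < n → P m + a m ≤ P (suc m)) where

  private
    slack : ℕ → ℕ
    slack m = P (suc m) ∸ (P m + a m)

    total : P n ≡ P 0 + sumTo n a + sumTo n slack
    total = begin-equality
      P n                                  ≡⟨ +-identityʳ (P n) ⟨
      P n + 0                              ≡⟨ cong (P n +_) (sumTo-zero n) ⟨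
      P n + sumTo n (λ _ → 0)              ≡⟨ telescope n P (λ _ → 0) (λ m → a m + slack m)
                                                (λ m m<n → trans (+-identityʳ _)
                                                  (trans (sym (m+[n∸m]≡n (rises m m<n))) (+-assoc (P m) _ _))) ⟩
      P 0 + sumTo n (λ m → a m + slack m)  ≡⟨ cong (P 0 +_) (sumTo-+ n a slack) ⟩
      P 0 + (sumTo n a + sumTo n slack)    ≡⟨ +-assoc (P 0) _ _ ⟨
      P 0 + sumTo n a + sumTo n slack      ∎

  rise-≥ : P 0 + sumTo n a ≤ P n
  rise-≥ = ≤-trans (m≤m+n _ _) (≤-reflexive (sym total))

  rise-tight : P 0 + sumTo n a ≡ P n → ∀ m → m < n → P m + a m ≡ P (suc m)
  rise-tight exact m m<n = begin-equality
    P m + a m             ≡⟨ +-identityʳ _ ⟨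
    P m + a m + 0         ≡⟨ cong (P m + a m +_) no-slack ⟨
    P m + a m + slack m   ≡⟨ m+[n∸m]≡n (rises m m<n) ⟩
    P (suc m)             ∎
    where
    no-slack : slack m ≡ 0
    no-slack = sumTo-≡0 n slack
      (+-cancelˡ-≡ (P 0 + sumTo n a) _ 0 (trans (sym total) (trans (sym exact) (sym (+-identityʳ _)))))
      m m<n

module RisesAtMost (n : ℕ) (P a : ℕ → ℕ) (rises-at-most : ∀ m → m < n → P (suc m) ≤ P m + a m) where

  private
    slack : ℕ → ℕ
    slack m = P m + a m ∸ P (suc m)

    total : P n + sumTo n slack ≡ P 0 + sumTo n a
    total = telescope n P slack a (λ m m<n → m+[n∸m]≡n (rises-at-most m m<n))

  rise-≤ : P n ≤ P 0 + sumTo n a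
  rise-≤ = ≤-trans (m≤m+n _ _) (≤-reflexive total)

  rise-tight : P n ≡ P 0 + sumTo n a → ∀ m → m < n → P (suc m) ≡ P m + a m
  rise-tight exact m m<n = begin-equality
    P (suc m)             ≡⟨ +-identityʳ _ ⟨
    P (suc m) + 0         ≡⟨ cong (P (suc m) +_) no-slack ⟨
    P (suc m) + slack m   ≡⟨ m+[n∸m]≡n (rises-at-most m m<n) ⟩
    P m + a m             ∎
    where
    no-slack : slack m ≡ 0
    no-slack = sumTo-≡0 n slack
      (+-cancelˡ-≡ (P n) _ 0 (trans total (trans (sym exact) (sym (+-identityʳ _)))))
      m m<n

module MatroidFacts {E : Set} (M : Matroid E) where
  open Matroid M

  r-submod-⊆ : ∀ {A B : Subset E} (X Y : Subset E) → A ⊆ X ∪ Y → B ⊆ X ∩ Y →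
               r A + r B ≤ r X + r Y
  r-submod-⊆ X Y A⊆ B⊆ = ≤-trans (+-mono-≤ (r-mono A⊆) (r-mono B⊆)) (r-submod X Y)

  r-∪-comm : ∀ (A B : Subset E) → r (A ∪ B) ≡ r (B ∪ A)
  r-∪-comm A B = r-resp (∪-swap {A} {B} , ∪-swap {B} {A})
    where
    ∪-swap : ∀ {P Q : Subset E} → P ∪ Q ⊆ Q ∪ P
    ∪-swap (inj₁ p) = inj₂ p
    ∪-swap (inj₂ q) = inj₁ q

  ⊆-cl : ∀ {S : Subset E} → S ⊆ cl M S
  ⊆-cl {S} s = r-resp ((λ { (inj₁ x) → x ; (inj₂ refl) → s }) , inj₁)

  -- If e does not raise the rank of S, it does not raise the rank of any
  -- superset T either (submodularity on T and S ∪ {e}).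
  cl-mono : ∀ {S T : Subset E} → S ⊆ T → cl M S ⊆ cl M T
  cl-mono {S} {T} S⊆T {e} e∈clS = ≤-antisym (+-cancelʳ-≤ (r S) _ _ (begin
    r (T ∪ ｛ e ｝) + r S   ≤⟨ r-submod-⊆ T (S ∪ ｛ e ｝)
                                 (λ { (inj₁ t) → inj₁ t ; (inj₂ x) → inj₂ (inj₂ x) })
                                 (λ s → S⊆T s , inj₁ s) ⟩
    r T + r (S ∪ ｛ e ｝)   ≡⟨ cong (r T +_) e∈clS ⟩
    r T + r S             ∎)) (r-mono inj₁)

  cl-least : ∀ {S F : Subset E} → IsFlat M F → S ⊆ F → cl M S ⊆ F
  cl-least {F = F} F-flat S⊆F {e} e∈clS = F-flat e (cl-mono S⊆F e∈clS)

  ⊆-cl-of-rank : ∀ {T P : Subset E} → T ⊆ P → r P ≤ r T → P ⊆ cl M T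
  ⊆-cl-of-rank T⊆P rP≤rT {e} e∈P = ≤-antisym
    (≤-trans (r-mono (λ { (inj₁ t) → T⊆P t ; (inj₂ refl) → e∈P })) rP≤rT) (r-mono inj₁)

  private
    r-add-closure-list : ∀ (S : Subset E) (L : List E) → All (cl M S) L → r (S ∪ listSet L) ≤ r S
    r-add-closure-list S []      []          =
      ≤-reflexive (r-resp ((λ { (inj₁ x) → x ; (inj₂ ()) }) , inj₁))
    r-add-closure-list S (x ∷ L) (x∈cl ∷ L⊆cl) = begin
      r (S ∪ listSet (x ∷ L))       ≡⟨ r-resp
        ((λ { (inj₁ s) → inj₁ (inj₁ s) ; (inj₂ (here refl)) → inj₂ refl ; (inj₂ (there l)) → inj₁ (inj₂ l) })
        , (λ { (inj₁ (inj₁ s)) → inj₁ s ; (inj₁ (inj₂ l)) → inj₂ (there l) ; (inj₂ refl) → inj₂ (here refl) })) ⟩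
      r ((S ∪ listSet L) ∪ ｛ x ｝) ≡⟨ cl-mono inj₁ x∈cl ⟩
      r (S ∪ listSet L)             ≤⟨ r-add-closure-list S L L⊆cl ⟩
      r S                           ∎

  -- Closure does not raise the rank; this is where finitarity of the rank
  -- function is used.
  r-cl : ∀ (S : Subset E) → r (cl M S) ≤ r S
  r-cl S with r-finitary (cl M S)
  ... | L , L⊆cl , rL≡ = begin
    r (cl M S)          ≡⟨ rL≡ ⟨
    r (listSet L)       ≤⟨ r-mono inj₂ ⟩
    r (S ∪ listSet L)   ≤⟨ r-add-closure-list S L L⊆cl ⟩
    r S                 ∎

  r-⊆-cl : ∀ {S T : Subset E} → T ⊆ cl M S → r T ≤ r S
  r-⊆-cl {S} T⊆clS = ≤-trans (r-mono T⊆clS) (r-cl S)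

-- A chain G₁ ⊆ ⋯ ⊆ Gₘ indexed by ℕ and padded with G₀ = ∅ and Gₙ = E for
-- n > m, so that positions in a chain can be compared and shifted freely.
module _ {E : Set} where

  -- chainAbove m G n = G_{n+1}
  chainAbove : (m : ℕ) → (Fin m → Subset E) → ℕ → Subset E
  chainAbove zero    G n       = U
  chainAbove (suc m) G zero    = G zero
  chainAbove (suc m) G (suc n) = chainAbove m (λ j → G (suc j)) n

  -- chainAt m G n = G_n
  chainAt : (m : ℕ) → (Fin m → Subset E) → ℕ → Subset E
  chainAt m G zero    = ∅
  chainAt m G (suc n) = chainAbove m G n

  ≡⇒⊆ : {A B : Subset E} → A ≡ B → A ⊆ B
  ≡⇒⊆ refl x = x

  ≡⇒≐ : {A B : Subset E} → A ≡ B → A ≐ B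
  ≡⇒≐ refl = ≐-refl

  extTop-chainAbove : ∀ m (G : Fin m → Subset E) i → extTop m G i ≡ chainAbove m G (toℕ i)
  extTop-chainAbove zero    G zero    = refl
  extTop-chainAbove (suc m) G zero    = refl
  extTop-chainAbove (suc m) G (suc i) = extTop-chainAbove m (λ j → G (suc j)) i

  ext-chainAt : ∀ m (G : Fin m → Subset E) x → ext m G x ≡ chainAt m G (toℕ x)
  ext-chainAt m G zero    = refl
  ext-chainAt m G (suc i) = extTop-chainAbove m G i

  chainAbove-member : ∀ m (G : Fin m → Subset E) j → chainAbove m G (toℕ j) ≡ G j
  chainAbove-member (suc m) G zero    = refl
  chainAbove-member (suc m) G (suc j) = chainAbove-member m (λ j → G (suc j)) j

  chainAbove-below : ∀ m (G : Fin m → Subset E) n (n<m : n < m) → chainAbove m G n ≡ G (fromℕ< n<m)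
  chainAbove-below m G n n<m =
    trans (cong (chainAbove m G) (sym (toℕ-fromℕ< n<m))) (chainAbove-member m G (fromℕ< n<m))

  chainAbove-top : ∀ m (G : Fin m → Subset E) n → m ≤ n → chainAbove m G n ≡ U
  chainAbove-top zero    G n       _         = refl
  chainAbove-top (suc m) G (suc n) (s≤s m≤n) = chainAbove-top m (λ j → G (suc j)) n m≤n

  Increasing : (m : ℕ) → (Fin m → Subset E) → Set
  Increasing m G = ∀ (i j : Fin m) → toℕ i < toℕ j → G i ⊆ G j

  private
    below-all : ∀ m (G : Fin m → Subset E) {A : Subset E} → (∀ j → A ⊆ G j) → ∀ n → A ⊆ chainAbove m G n
    below-all zero    G A⊆ n       _ = tt
    below-all (suc m) G A⊆ zero      = A⊆ zero
    below-all (suc m) G A⊆ (suc n)   = below-all m (λ j → G (suc j)) (λ j → A⊆ (suc j)) n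

  chainAbove-mono : ∀ m (G : Fin m → Subset E) → Increasing m G →
                    ∀ {n n′} → n ≤ n′ → chainAbove m G n ⊆ chainAbove m G n′
  chainAbove-mono zero    G inc _                 = λ x → x
  chainAbove-mono (suc m) G inc {zero} {zero}   _ = λ x → x
  chainAbove-mono (suc m) G inc {zero} {suc n′} _ =
    below-all m (λ j → G (suc j)) (λ j → inc zero (suc j) (s≤s z≤n)) n′
  chainAbove-mono (suc m) G inc {suc n} {suc n′} (s≤s n≤n′) =
    chainAbove-mono m (λ j → G (suc j)) (λ i j i<j → inc (suc i) (suc j) (s≤s i<j)) n≤n′

  chainAt-mono : ∀ m (G : Fin m → Subset E) → Increasing m G →
                 ∀ {n n′} → n ≤ n′ → chainAt m G n ⊆ chainAt m G n′
  chainAt-mono m G inc {zero}  _           ()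
  chainAt-mono m G inc {suc n} (s≤s n≤n′) = chainAbove-mono m G inc n≤n′

module Refinement {E : Set} (M : Matroid E)
  (k : ℕ) (F : Fin k → Subset E) (k′ : ℕ) (F′ : Fin k′ → Subset E)
  (F-chain : IsChainOfFlats M k F) (F′-chain : IsChainOfFlats M k′ F′)
  (F⊆F′ : ∀ (i : Fin k) → Σ (Fin k′) (λ j → F i ≐ F′ j))
  (X : Fin (suc k) → Subset E)
  (X-layer : ∀ (i : Fin (suc k)) → X i ⊆ (hi M k F i ∖ lo M k F i)) where

  open Matroid M
  open MatroidFacts M

  Y : Subset E
  Y = ⋃ (Fin (suc k)) X

  Fₙ F′ₙ : ℕ → Subset E
  Fₙ  = chainAt k F
  F′ₙ = chainAt k′ F′

  Fₙ-mono : ∀ {n n′} → n ≤ n′ → Fₙ n ⊆ Fₙ n′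
  Fₙ-mono = chainAt-mono k F (λ i j i<j → proj₁ (proj₂ F-chain i j i<j))

  F′ₙ-mono : ∀ {n n′} → n ≤ n′ → F′ₙ n ⊆ F′ₙ n′
  F′ₙ-mono = chainAt-mono k′ F′ (λ i j i<j → proj₁ (proj₂ F′-chain i j i<j))

  F′ₙ-top : F′ₙ (suc k′) ≡ U
  F′ₙ-top = chainAbove-top k′ F′ k′ ≤-refl

  -- pos n is the position in F′ of the coarse flat F_n.
  pos : ℕ → ℕ
  pos zero    = zero
  pos (suc n) with n <? k
  ... | yes n<k = suc (toℕ (proj₁ (F⊆F′ (fromℕ< n<k))))
  ... | no  _   = suc k′

  pos-≤ : ∀ n → pos n ≤ suc k′
  pos-≤ zero    = z≤n
  pos-≤ (suc n) with n <? k
  ... | yes n<k = s≤s (<⇒≤ (toℕ<n (proj₁ (F⊆F′ (fromℕ< n<k)))))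
  ... | no  _   = ≤-refl

  pos-top : pos (suc k) ≡ suc k′
  pos-top with k <? k
  ... | yes k<k = ⊥-elim (<-irrefl refl k<k)
  ... | no  _   = refl

  Fₙ≐F′ₙ-pos : ∀ n → Fₙ n ≐ F′ₙ (pos n)
  Fₙ≐F′ₙ-pos zero    = ≐-refl
  Fₙ≐F′ₙ-pos (suc n) with n <? k
  ... | yes n<k = ≐-trans (≡⇒≐ (chainAbove-below k F n n<k))
                    (≐-trans (proj₂ (F⊆F′ (fromℕ< n<k)))
                      (≐-sym (≡⇒≐ (chainAbove-member k′ F′ (proj₁ (F⊆F′ (fromℕ< n<k)))))))
  ... | no  n≮k = ≐-trans (≡⇒≐ (chainAbove-top k F n (≮⇒≥ n≮k))) (≐-sym (≡⇒≐ F′ₙ-top))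

  low high : Fin (suc k) → Subset E
  low  i = lo M k F i
  high i = hi M k F i

  lowPos highPos : Fin (suc k) → ℕ
  lowPos  i = pos (toℕ i)
  highPos i = pos (suc (toℕ i))

  low≡Fₙ : ∀ i → low i ≡ Fₙ (toℕ i)
  low≡Fₙ i = trans (ext-chainAt k F (inject₁ i)) (cong Fₙ (toℕ-inject₁ i))

  high≡Fₙ : ∀ i → high i ≡ Fₙ (suc (toℕ i))
  high≡Fₙ i = ext-chainAt k F (suc i)

  low≐F′ₙ : ∀ i → low i ≐ F′ₙ (lowPos i)
  low≐F′ₙ i = ≐-trans (≡⇒≐ (low≡Fₙ i)) (Fₙ≐F′ₙ-pos (toℕ i))

  high≐F′ₙ : ∀ i → high i ≐ F′ₙ (highPos i)
  high≐F′ₙ i = ≐-trans (≡⇒≐ (high≡Fₙ i)) (Fₙ≐F′ₙ-pos (suc (toℕ i)))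

  low⊆high : ∀ i → low i ⊆ high i
  low⊆high i x = ≡⇒⊆ (sym (high≡Fₙ i)) (Fₙ-mono (n≤1+n _) (≡⇒⊆ (low≡Fₙ i) x))

  low-mono : ∀ {i i′} → toℕ i ≤ toℕ i′ → low i ⊆ low i′
  low-mono {i} {i′} i≤i′ x = ≡⇒⊆ (sym (low≡Fₙ i′)) (Fₙ-mono i≤i′ (≡⇒⊆ (low≡Fₙ i) x))

  high⊆low : ∀ {i i′} → toℕ i < toℕ i′ → high i ⊆ low i′
  high⊆low {i} {i′} i<i′ x = ≡⇒⊆ (sym (low≡Fₙ i′)) (Fₙ-mono i<i′ (≡⇒⊆ (high≡Fₙ i) x))

  X⊆F′ₙ-high : ∀ i → X i ⊆ F′ₙ (highPos i)
  X⊆F′ₙ-high i x = proj₁ (high≐F′ₙ i) (proj₁ (X-layer i x))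

  InLayer : Fin (suc k) → ℕ → Set
  InLayer i m = lowPos i ≤ m × suc m ≤ highPos i

  inLayer-range : ∀ {i m} → InLayer i m → m < suc k′
  inLayer-range {i} (_ , m<high) = ≤-trans m<high (pos-≤ _)

  inLayer-low : ∀ {i m} → InLayer i m → low i ⊆ F′ₙ m
  inLayer-low {i} (low≤m , _) x = F′ₙ-mono low≤m (proj₁ (low≐F′ₙ i) x)

  inLayer-high : ∀ {i m} → InLayer i m → F′ₙ (suc m) ⊆ high i
  inLayer-high {i} (_ , m<high) x = proj₂ (high≐F′ₙ i) (F′ₙ-mono m<high x)

  private
    find-step : ∀ m K (f : ℕ → ℕ) → f 0 ≤ m → m < f K → Σ ℕ λ n → n < K × f n ≤ m × m < f (suc n)
    find-step m zero    f f0≤m m<fK = ⊥-elim (<-irrefl refl (≤-<-trans f0≤m m<fK))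
    find-step m (suc K) f f0≤m m<fK with m <? f 1
    ... | yes m<f1 = 0 , s≤s z≤n , f0≤m , m<f1
    ... | no  m≮f1 with find-step m K (λ n → f (suc n)) (≮⇒≥ m≮f1) m<fK
    ...   | n , n<K , fn≤m , m<fn+1 = suc n , s≤s n<K , fn≤m , m<fn+1

  layer-of : ∀ m → m < suc k′ → Σ (Fin (suc k)) λ i → InLayer i m
  layer-of m m<k′+1 with find-step m (suc k) pos z≤n (subst (m <_) (sym pos-top) m<k′+1)
  ... | n , n<k+1 , pos-n≤m , m<pos-n+1 =
    fromℕ< n<k+1 ,
    subst (λ x → pos x ≤ m) (sym (toℕ-fromℕ< n<k+1)) pos-n≤m ,
    subst (λ x → m < pos (suc x)) (sym (toℕ-fromℕ< n<k+1)) m<pos-n+1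

  Y-between : ∀ i {P Q : Subset E} → low i ⊆ P → Q ⊆ high i → Y ∩ (Q ∖ P) ⊆ X i
  Y-between i low⊆P Q⊆high {e} ((i′ , e∈Xi′) , e∈Q , e∉P) with <-cmp (toℕ i′) (toℕ i)
  ... | tri< i′<i _ _ = ⊥-elim (e∉P (low⊆P (high⊆low i′<i (proj₁ (X-layer i′ e∈Xi′)))))
  ... | tri≈ _ i′≡i _ = subst (λ j → X j e) (toℕ-injective i′≡i) e∈Xi′
  ... | tri> _ _ i<i′ = ⊥-elim (proj₂ (X-layer i′ e∈Xi′) (high⊆low i<i′ (Q⊆high e∈Q)))

  -- Truncating at the top of the fine chain gives r_{M⋆F} and φ(F, ·).
  t : Fin (suc k) → Subset E → ℕ
  t i S = r (low i ∪ (X i ∩ S))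

  c : Fin (suc k) → ℕ
  c i = r (low i)

  R Ψ : Subset E → ℕ
  R S = ∑ (suc k) λ i → t i S ∸ c i
  Ψ S = ∑ (suc k) λ i → t i S * t i S ∸ c i * c i

  c≤t : ∀ i S → c i ≤ t i S
  c≤t i S = r-mono inj₁

  Y′ : ℕ → Subset E
  Y′ m = Y ∩ (F′ₙ (suc m) ∖ F′ₙ m)

  b a : ℕ → ℕ
  b m = r (F′ₙ m)
  a m = r (F′ₙ m ∪ Y′ m)

  D A : ℕ → ℕ
  D m = a m ∸ b m
  A m = a m * a m ∸ b m * b m

  b≤a : ∀ m → b m ≤ a m
  b≤a m = r-mono inj₁

  t≤b : ∀ {i m} → InLayer i m → t i (F′ₙ m) ≤ b m
  t≤b inl = r-mono λ { (inj₁ x) → inLayer-low inl x ; (inj₂ (_ , x)) → x }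

  -- Submodularity on F′_m and low i ∪ (X i ∩ F′_{m+1}): what fine step m
  -- adds to F′_m is at most what it adds to the truncated coarse piece.
  step-submod : ∀ {i m} → InLayer i m → a m + t i (F′ₙ m) ≤ b m + t i (F′ₙ (suc m))
  step-submod {i} {m} inl = r-submod-⊆ (F′ₙ m) (low i ∪ (X i ∩ F′ₙ (suc m)))
    (λ { (inj₁ x) → inj₁ x
       ; (inj₂ y) → inj₂ (inj₂ (Y-between i (inLayer-low inl) (inLayer-high inl) y , proj₁ (proj₂ y))) })
    (λ { (inj₁ x) → inLayer-low inl x , inj₁ x
       ; (inj₂ (z , x)) → x , inj₂ (z , F′ₙ-mono (n≤1+n m) x) })

  step-other : ∀ {i m} → InLayer i m → ∀ i′ → i′ ≢ i → t i′ (F′ₙ m) ≡ t i′ (F′ₙ (suc m))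
  step-other {i} {m} inl i′ i′≢i = r-resp (grow , shrink)
    where
    grow : low i′ ∪ (X i′ ∩ F′ₙ m) ⊆ low i′ ∪ (X i′ ∩ F′ₙ (suc m))
    grow (inj₁ x)       = inj₁ x
    grow (inj₂ (z , x)) = inj₂ (z , F′ₙ-mono (n≤1+n m) x)
    shrink : low i′ ∪ (X i′ ∩ F′ₙ (suc m)) ⊆ low i′ ∪ (X i′ ∩ F′ₙ m)
    shrink (inj₁ x)       = inj₁ x
    shrink (inj₂ (z , x)) with <-cmp (toℕ i′) (toℕ i)
    ... | tri< i′<i _ _ = inj₂ (z , inLayer-low inl (high⊆low i′<i (proj₁ (X-layer i′ z))))
    ... | tri≈ _ i′≡i _ = ⊥-elim (i′≢i (toℕ-injective i′≡i))
    ... | tri> _ _ i<i′ = ⊥-elim (proj₂ (X-layer i′ z) (high⊆low i<i′ (inLayer-high inl x)))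

  step-∑ : ∀ {i m} → InLayer i m → (f : ℕ → ℕ → ℕ) →
           ∑ (suc k) (λ i′ → f (c i′) (t i′ (F′ₙ m))) + f (c i) (t i (F′ₙ (suc m)))
             ≡ ∑ (suc k) (λ i′ → f (c i′) (t i′ (F′ₙ (suc m)))) + f (c i) (t i (F′ₙ m))
  step-∑ {i} {m} inl f = ∑-update (suc k) _ _ i
    (λ i′ i′≢i → cong (f (c i′)) (step-other inl i′ i′≢i))

  R-step : ∀ {i m} → InLayer i m → R (F′ₙ m) + D m ≤ R (F′ₙ (suc m))
  R-step {i} {m} inl = exchange-≤ (D m) (step-∑ inl (λ x y → y ∸ x))
    (gain-≤ (c≤t i _) (b≤a m) (c≤t i _) (step-submod inl))

  R-step-tight : ∀ {i m} → InLayer i m → R (F′ₙ m) + D m ≡ R (F′ₙ (suc m)) →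
                 a m + t i (F′ₙ m) ≡ b m + t i (F′ₙ (suc m))
  R-step-tight {i} {m} inl exact = gain-≡ (c≤t i _) (b≤a m) (c≤t i _)
    (Equivalence.to (exchange-≡ (D m) (step-∑ inl (λ x y → y ∸ x))) exact)

  Tight : Fin (suc k) → ℕ → Set
  Tight i m = b m ≤ t i (F′ₙ m) ⊎ a m ≤ b m

  Ψ-step : ∀ {i m} → InLayer i m → a m + t i (F′ₙ m) ≡ b m + t i (F′ₙ (suc m)) →
           Ψ (F′ₙ (suc m)) ≤ Ψ (F′ₙ m) + A m
  Ψ-step {i} {m} inl exact = exchange-≥ (A m) (step-∑ inl (λ x y → y * y ∸ x * x))
    (square-≤ (c≤t i _) (t≤b inl) (b≤a m) exact)

  Ψ-step-tight : ∀ {i m} → InLayer i m → a m + t i (F′ₙ m) ≡ b m + t i (F′ₙ (suc m)) →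
                 (Ψ (F′ₙ (suc m)) ≡ Ψ (F′ₙ m) + A m) ⇔ Tight i m
  Ψ-step-tight {i} {m} inl exact =
    ⇔.trans ≡-sym (⇔.trans (exchange-≡ (A m) (step-∑ inl (λ x y → y * y ∸ x * x)))
                    (⇔.trans ≡-sym (square-tight (c≤t i _) (t≤b inl) (b≤a m) exact)))
    where
    ≡-sym : ∀ {x y : ℕ} → (x ≡ y) ⇔ (y ≡ x)
    ≡-sym = mk⇔ sym sym

  t-bottom : ∀ i → t i (F′ₙ 0) ≡ c i
  t-bottom i = r-resp ((λ { (inj₁ x) → x ; (inj₂ (_ , ())) }) , inj₁)

  R-bottom : R (F′ₙ 0) ≡ 0
  R-bottom = trans (∑-cong (suc k) λ i → trans (cong (_∸ c i) (t-bottom i)) (n∸n≡0 (c i)))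
                   (∑-zero (suc k))

  Ψ-bottom : Ψ (F′ₙ 0) ≡ 0
  Ψ-bottom = trans (∑-cong (suc k) λ i → trans (cong (λ x → x * x ∸ c i * c i) (t-bottom i))
                                               (n∸n≡0 (c i * c i)))
                   (∑-zero (suc k))

  coarse-piece : ∀ i → low i ∪ (Y ∩ (high i ∖ low i)) ≐ low i ∪ (X i ∩ F′ₙ (suc k′))
  coarse-piece i =
    (λ { (inj₁ x) → inj₁ x
       ; (inj₂ y) → inj₂ (Y-between i (λ x → x) (λ x → x) y , ≡⇒⊆ (sym F′ₙ-top) tt) }) ,
    (λ { (inj₁ x) → inj₁ x ; (inj₂ (z , _)) → inj₂ ((i , z) , X-layer i z) })

  rStar-coarse : rStar M k F Y ≡ R (F′ₙ (suc k′))
  rStar-coarse = ∑-cong (suc k) λ i →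
    cong (_∸ c i) (trans (r-∪-comm _ (low i)) (r-resp (coarse-piece i)))

  φ-coarse : φ M k F Y ≡ Ψ (F′ₙ (suc k′))
  φ-coarse = ∑-cong (suc k) λ i →
    cong (λ x → x * x ∸ c i * c i) (r-resp (coarse-piece i))

  fineLow≡ : ∀ j → lo M k′ F′ j ≡ F′ₙ (toℕ j)
  fineLow≡ j = trans (ext-chainAt k′ F′ (inject₁ j)) (cong F′ₙ (toℕ-inject₁ j))

  fineHigh≡ : ∀ j → hi M k′ F′ j ≡ F′ₙ (suc (toℕ j))
  fineHigh≡ j = ext-chainAt k′ F′ (suc j)

  rStar-fine : rStar M k′ F′ Y ≡ sumTo (suc k′) D
  rStar-fine = trans (∑-cong (suc k′) λ j → let m = toℕ j in
      trans (cong₂ (λ L H → r ((Y ∩ (H ∖ L)) ∪ L) ∸ r L) (fineLow≡ j) (fineHigh≡ j))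
            (cong (_∸ b m) (r-∪-comm (Y′ m) (F′ₙ m))))
    (∑-toℕ (suc k′) D)

  φ-fine : φ M k′ F′ Y ≡ sumTo (suc k′) A
  φ-fine = trans (∑-cong (suc k′) λ j →
      cong₂ (λ L H → r (L ∪ (Y ∩ (H ∖ L))) * r (L ∪ (Y ∩ (H ∖ L))) ∸ r L * r L)
            (fineLow≡ j) (fineHigh≡ j))
    (∑-toℕ (suc k′) A)

  module EqualRank (rank-eq : rStar M k F Y ≡ rStar M k′ F′ Y) where

    R-rises : ∀ m → m < suc k′ → R (F′ₙ m) + D m ≤ R (F′ₙ (suc m))
    R-rises m m<k′+1 = R-step (proj₂ (layer-of m m<k′+1))

    -- Summing R-step over the whole fine chain reproduces the rank equality,
    -- so every instance of step-submod is an equality.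
    exact : ∀ {i m} → InLayer i m → a m + t i (F′ₙ m) ≡ b m + t i (F′ₙ (suc m))
    exact {i} {m} inl = R-step-tight inl
      (rise-tight total m (inLayer-range inl))
      where
      open RisesAtLeast (suc k′) (λ n → R (F′ₙ n)) D R-rises
      total : R (F′ₙ 0) + sumTo (suc k′) D ≡ R (F′ₙ (suc k′))
      total = begin-equality
        R (F′ₙ 0) + sumTo (suc k′) D ≡⟨ cong₂ _+_ R-bottom (sym rStar-fine) ⟩
        rStar M k′ F′ Y              ≡⟨ trans (sym rank-eq) rStar-coarse ⟩
        R (F′ₙ (suc k′))             ∎

    Ψ-rises-at-most : ∀ m → m < suc k′ → Ψ (F′ₙ (suc m)) ≤ Ψ (F′ₙ m) + A m
    Ψ-rises-at-most m m<k′+1 = let (i , inl) = layer-of m m<k′+1 in Ψ-step inl (exact inl)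

    open RisesAtMost (suc k′) (λ n → Ψ (F′ₙ n)) A Ψ-rises-at-most
      renaming (rise-≤ to Ψ-total-≤; rise-tight to Ψ-total-tight)

    φ-fine≡ : φ M k′ F′ Y ≡ Ψ (F′ₙ 0) + sumTo (suc k′) A
    φ-fine≡ = trans φ-fine (cong (_+ sumTo (suc k′) A) (sym Ψ-bottom))

    φ-≤ : φ M k F Y ≤ φ M k′ F′ Y
    φ-≤ = begin
      φ M k F Y                        ≡⟨ φ-coarse ⟩
      Ψ (F′ₙ (suc k′))                 ≤⟨ Ψ-total-≤ ⟩
      Ψ (F′ₙ 0) + sumTo (suc k′) A     ≡⟨ φ-fine≡ ⟨
      φ M k′ F′ Y                      ∎

    AllTight : Set
    AllTight = ∀ i m → InLayer i m → Tight i m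

    φ-tight⇔ : (φ M k F Y ≡ φ M k′ F′ Y) ⇔ AllTight
    φ-tight⇔ = mk⇔
      (λ φ≡ i m inl → Equivalence.to (Ψ-step-tight inl (exact inl))
         (Ψ-total-tight (trans (sym φ-coarse) (trans φ≡ φ-fine≡)) m (inLayer-range inl)))
      (λ all-tight → trans φ-coarse (trans (≤-antisym Ψ-total-≤
         (RisesAtLeast.rise-≥ (suc k′) (λ n → Ψ (F′ₙ n)) A
            (λ m m<k′+1 → ≤-reflexive (sym (steps-exact all-tight m m<k′+1)))))
         (sym φ-fine≡)))
      where
      steps-exact : AllTight → ∀ m → m < suc k′ → Ψ (F′ₙ (suc m)) ≡ Ψ (F′ₙ m) + A m
      steps-exact all-tight m m<k′+1 = let (i , inl) = layer-of m m<k′+1 in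
        Equivalence.from (Ψ-step-tight inl (exact inl)) (all-tight i m inl)

    C : Fin (suc k) → Subset E
    C i = _∨_ M (low i) (X i)

    piece-rank : ∀ i {S : Subset E} → X i ⊆ S → r (low i ∪ X i) ≤ t i S
    piece-rank i X⊆S = r-mono λ { (inj₁ x) → inj₁ x ; (inj₂ z) → inj₂ (z , X⊆S z) }

    C-ordered : ∀ {i i′} → toℕ i < toℕ i′ → C i ⊆ C i′
    C-ordered {i} {i′} i<i′ = cl-mono λ
      { (inj₁ x) → inj₁ (low-mono (<⇒≤ i<i′) x)
      ; (inj₂ z) → inj₁ (high⊆low i<i′ (proj₁ (X-layer i z))) }

    F′-ordered : ∀ {j j′} → toℕ j < toℕ j′ → F′ j ⊆ F′ j′
    F′-ordered {j} {j′} = proj₁ ∘′ proj₂ F′-chain j j′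

    F′ₙ-member : ∀ j → F′ₙ (suc (toℕ j)) ≡ F′ j
    F′ₙ-member = chainAbove-member k′ F′

    inLayer-before-end : ∀ {i d m} → lowPos i ≤ m → suc d + m ≡ highPos i → InLayer i m
    inLayer-before-end {d = d} {m} low≤m e = low≤m , subst (suc m ≤_) e (s≤s (m≤n+m m d))

    one-step-on : ∀ {i} d m → suc d + m ≡ highPos i → d + suc m ≡ highPos i
    one-step-on d m e = trans (+-suc d m) e

    stagnant-step : ∀ {i m} → InLayer i m → a m ≤ b m → t i (F′ₙ m) ≡ t i (F′ₙ (suc m))
    stagnant-step {i} {m} inl a≤b = +-cancelˡ-≡ (b m) _ _
      (trans (cong (_+ t i (F′ₙ m)) (sym (≤-antisym a≤b (b≤a m)))) (exact inl))

    deficit-persists : AllTight → ∀ i d m → d + m ≡ highPos i → lowPos i ≤ m →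
                       t i (F′ₙ m) < b m → r (low i ∪ X i) ≤ t i (F′ₙ m)
    deficit-persists all-tight i zero    m m≡high low≤m _ =
      piece-rank i (λ z → subst (λ n → F′ₙ n _) (sym m≡high) (X⊆F′ₙ-high i z))
    deficit-persists all-tight i (suc d) m e      low≤m t<b
      with all-tight i m (inLayer-before-end low≤m e)
    ... | inj₁ b≤t = ⊥-elim (<⇒≱ t<b b≤t)
    ... | inj₂ a≤b = subst (r (low i ∪ X i) ≤_) (sym t-same)
      (deficit-persists all-tight i d (suc m) (one-step-on d m e) (≤-trans low≤m (n≤1+n m))
        (subst (_< b (suc m)) t-same (<-≤-trans t<b (r-mono (F′ₙ-mono (n≤1+n m))))))
      where
      t-same : t i (F′ₙ m) ≡ t i (F′ₙ (suc m))
      t-same = stagnant-step (inLayer-before-end low≤m e) a≤b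

    truncation⊆F′ₙ : ∀ i {m} → lowPos i ≤ m → low i ∪ (X i ∩ F′ₙ m) ⊆ F′ₙ m
    truncation⊆F′ₙ i low≤m (inj₁ x)       = F′ₙ-mono low≤m (proj₁ (low≐F′ₙ i) x)
    truncation⊆F′ₙ i low≤m (inj₂ (_ , x)) = x

    truncation⊆piece : ∀ i {S : Subset E} → low i ∪ (X i ∩ S) ⊆ low i ∪ X i
    truncation⊆piece i (inj₁ x)       = inj₁ x
    truncation⊆piece i (inj₂ (z , _)) = inj₂ z

    -- Under AllTight every flat F′ j = F′_m is comparable with every C i:
    -- below layer i it is inside F_i, above it contains F_{i+1}, and inside
    -- it either spans F′_m (then F′_m ⊆ C i) or, by deficit-persists, it
    -- spans all of low i ∪ X i (then C i ⊆ F′_m).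
    F′-vs-C : AllTight → ∀ j i → (F′ j ⊆ C i) ⊎ (C i ⊆ F′ j)
    F′-vs-C all-tight j i with suc (toℕ j) ≤? lowPos i
    ... | yes m≤low = inj₁ λ x →
      ⊆-cl (inj₁ (proj₂ (low≐F′ₙ i) (F′ₙ-mono m≤low (≡⇒⊆ (sym (F′ₙ-member j)) x))))
    ... | no m≰low with highPos i ≤? suc (toℕ j)
    ...   | yes high≤m = inj₂ (cl-least (proj₁ F′-chain j) λ
      { (inj₁ x) → high⊆F′ (proj₁ (high≐F′ₙ i) (low⊆high i x))
      ; (inj₂ z) → high⊆F′ (X⊆F′ₙ-high i z) })
      where
      high⊆F′ : F′ₙ (highPos i) ⊆ F′ j
      high⊆F′ x = ≡⇒⊆ (F′ₙ-member j) (F′ₙ-mono high≤m x)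
    ...   | no high≰m with t i (F′ₙ (suc (toℕ j))) <? b (suc (toℕ j))
    ...     | yes deficit = inj₂ (cl-least (proj₁ F′-chain j) piece⊆F′)
      where
      low≤m : lowPos i ≤ suc (toℕ j)
      low≤m = <⇒≤ (≰⇒> m≰low)
      piece⊆cl : low i ∪ X i ⊆ cl M (low i ∪ (X i ∩ F′ₙ (suc (toℕ j))))
      piece⊆cl = ⊆-cl-of-rank (truncation⊆piece i {F′ₙ (suc (toℕ j))})
        (deficit-persists all-tight i _ _ (m∸n+n≡m (<⇒≤ (≰⇒> high≰m))) low≤m deficit)
      piece⊆F′ : low i ∪ X i ⊆ F′ j
      piece⊆F′ x = cl-least (proj₁ F′-chain j)
        (λ y → ≡⇒⊆ (F′ₙ-member j) (truncation⊆F′ₙ i low≤m y)) (piece⊆cl x)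
    ...     | no no-deficit = inj₁ λ x → cl-mono (truncation⊆piece i {F′ₙ (suc (toℕ j))})
      (⊆-cl-of-rank (truncation⊆F′ₙ i (<⇒≤ (≰⇒> m≰low))) (≮⇒≥ no-deficit)
        (≡⇒⊆ (sym (F′ₙ-member j)) x))

    Chain : Set
    Chain = IsChainFamily {E} {Fin k′ ⊎ Fin (suc k)} [ F′ , C ]

    chain-of-tight : AllTight → Chain
    chain-of-tight all-tight (inj₁ j) (inj₁ j′) with <-cmp (toℕ j) (toℕ j′)
    ... | tri< j<j′ _ _ = inj₁ (F′-ordered j<j′)
    ... | tri≈ _ j≡j′ _ = inj₁ (≡⇒⊆ (cong F′ (toℕ-injective j≡j′)))
    ... | tri> _ _ j′<j = inj₂ (F′-ordered j′<j)
    chain-of-tight all-tight (inj₁ j) (inj₂ i) = F′-vs-C all-tight j i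
    chain-of-tight all-tight (inj₂ i) (inj₁ j) = swap (F′-vs-C all-tight j i)
    chain-of-tight all-tight (inj₂ i) (inj₂ i′) with <-cmp (toℕ i) (toℕ i′)
    ... | tri< i<i′ _ _ = inj₁ (C-ordered i<i′)
    ... | tri≈ _ i≡i′ _ = inj₁ (≡⇒⊆ (cong C (toℕ-injective i≡i′)))
    ... | tri> _ _ i′<i = inj₂ (C-ordered i′<i)

    F′ₙ-vs-C : Chain → ∀ i n → (F′ₙ (suc n) ⊆ C i) ⊎ (C i ⊆ F′ₙ (suc n))
    F′ₙ-vs-C chain i n with n <? k′
    ... | yes n<k′ with chain (inj₁ (fromℕ< n<k′)) (inj₂ i)
    ...   | inj₁ F′⊆C = inj₁ λ x → F′⊆C (≡⇒⊆ (chainAbove-below k′ F′ n n<k′) x)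
    ...   | inj₂ C⊆F′ = inj₂ λ x → ≡⇒⊆ (sym (chainAbove-below k′ F′ n n<k′)) (C⊆F′ x)
    F′ₙ-vs-C chain i n | no n≮k′ = inj₂ λ _ → ≡⇒⊆ (sym (chainAbove-top k′ F′ n (≮⇒≥ n≮k′))) tt

    covered-spanned : Chain → ∀ i d m → d + m ≡ highPos i → lowPos i ≤ m →
                      F′ₙ m ⊆ C i → b m ≤ t i (F′ₙ m)
    covered-spanned chain i zero    m m≡high low≤m F′⊆C = begin
      b m                  ≤⟨ r-⊆-cl F′⊆C ⟩
      r (low i ∪ X i)      ≤⟨ piece-rank i (λ z → subst (λ n → F′ₙ n _) (sym m≡high) (X⊆F′ₙ-high i z)) ⟩
      t i (F′ₙ m)          ∎
    covered-spanned chain i (suc d) m e      low≤m F′⊆C =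
      cross-≤ (exact inl) a≤t-next
      where
      inl : InLayer i m
      inl = inLayer-before-end low≤m e
      a≤t-next : a m ≤ t i (F′ₙ (suc m))
      a≤t-next with F′ₙ-vs-C chain i m
      ... | inj₁ F′⊆C′ = begin
        a m                  ≤⟨ r-mono (λ { (inj₁ x) → F′ₙ-mono (n≤1+n m) x ; (inj₂ y) → proj₁ (proj₂ y) }) ⟩
        b (suc m)            ≤⟨ covered-spanned chain i d (suc m) (one-step-on d m e) (≤-trans low≤m (n≤1+n m)) F′⊆C′ ⟩
        t i (F′ₙ (suc m))    ∎
      ... | inj₂ C⊆F′ = begin
        a m                  ≤⟨ r-⊆-cl (λ { (inj₁ x) → F′⊆C x
                                         ; (inj₂ y) → ⊆-cl (inj₂ (Y-between i (inLayer-low inl) (inLayer-high inl) y)) }) ⟩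
        r (low i ∪ X i)      ≤⟨ piece-rank i (λ z → C⊆F′ (⊆-cl (inj₂ z))) ⟩
        t i (F′ₙ (suc m))    ∎

    -- In a chain, every fine step is Tight: either F′_m ⊆ C i and
    -- covered-spanned applies, or C i ⊆ F′_m and Y has nothing left in step m.
    tight-of-chain : Chain → AllTight
    tight-of-chain chain i zero      inl = inj₁ (≤-trans (≤-reflexive r-empty) z≤n)
    tight-of-chain chain i (suc m₀) inl@(low≤m , m<high) with F′ₙ-vs-C chain i m₀
    ... | inj₁ F′⊆C = inj₁ (covered-spanned chain i _ _ (m∸n+n≡m (<⇒≤ m<high)) low≤m F′⊆C)
    ... | inj₂ C⊆F′ = inj₂ (r-mono λ
      { (inj₁ x) → x
      ; (inj₂ y) → ⊥-elim (proj₂ (proj₂ y)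
          (C⊆F′ (⊆-cl (inj₂ (Y-between i (inLayer-low inl) (inLayer-high inl) y))))) })

    tight⇔chain : AllTight ⇔ Chain
    tight⇔chain = mk⇔ chain-of-tight tight-of-chain

lemma3 : {E : Set} (M : Matroid E)
         (k : ℕ) (F : Fin k → Subset E) (k′ : ℕ) (F′ : Fin k′ → Subset E) →
         IsChainOfFlats M k F → IsChainOfFlats M k′ F′ →
         (∀ (i : Fin k) → Σ (Fin k′) (λ j → F i ≐ F′ j)) →
         k < k′ →
         (X : Fin (suc k) → Subset E) →
         (∀ (i : Fin (suc k)) → X i ⊆ (hi M k F i ∖ lo M k F i)) →
         rStar M k F (⋃ (Fin (suc k)) X) ≡ rStar M k′ F′ (⋃ (Fin (suc k)) X) →
         (φ M k F (⋃ (Fin (suc k)) X) ≤ φ M k′ F′ (⋃ (Fin (suc k)) X))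
         × ((φ M k F (⋃ (Fin (suc k)) X) ≡ φ M k′ F′ (⋃ (Fin (suc k)) X))
            ⇔ IsChainFamily {E} {Fin k′ ⊎ Fin (suc k)}
                [ F′ , (λ i → _∨_ M (lo M k F i) (X i)) ])
lemma3 M k F k′ F′ F-chain F′-chain F⊆F′ _ X X-layer rank-eq =
  φ-≤ , ⇔.trans φ-tight⇔ tight⇔chain
  where
  open Refinement.EqualRank M k F k′ F′ F-chain F′-chain F⊆F′ X X-layer rank-eq
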